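{- Let $H(z;u,v)\equiv H(u,v)$ be a series in $\mathbb{Q}[u,v][[z]]$ that is symmetric in $u$ and $v$, and let $H_1(u,v):=\Lambda H(u,v)$. Then $H_1(u,v)$ is symmetric in $u$ and $v$ if and only if $$H(u,v)=\frac{u(1+v)(1+zv)H(u,0)-v(1+u)(1+zu)H(v,0)}{(u-v)(1-zuv)}.$$ If this holds, then $H_1$ also satisfies the same identity (with $H$ replaced by $H_1$), and consequently, by induction, the same holds for $H_k(u,v):=\Lambda^{(k)}H(u,v)$ for every $k\ge1$.
   Context: The operator $\Lambda$ is defined on $\mathbb{Q}[u,v][[z]]$ by $\Lambda H(z;u,v)=(1+u)(1+zu)\dfrac{H(z;u,v)-H(z;0,v)}{u}$, and $\Lambda^{(k)}$ denotes its $k$-fold iterate. -}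

module Defs where

open import Data.Nat using (ℕ; zero; suc; _<_)
open import Data.Rational using (ℚ; 0ℚ; _+_; _-_)
open import Data.Product using (Σ; _×_)
open import Relation.Binary.PropositionalEquality using (_≡_)

-- An element of ℚ[[z,u,v]] given by its coefficients:
-- S n i j = coefficient of z^n u^i v^j.
Series : Set
Series = ℕ → ℕ → ℕ → ℚ

-- Membership in ℚ[u,v][[z]]: each z^n-coefficient is a polynomial in u,v.
PolyCoeffs : Series → Set
PolyCoeffs H = ∀ n → Σ ℕ λ B → ∀ i j → (B < i → H n i j ≡ 0ℚ) × (B < j → H n i j ≡ 0ℚ)

_≈_ : Series → Series → Set
F ≈ G = ∀ n i j → F n i j ≡ G n i j
infix 4 _≈_

_⊕_ : Series → Series → Series
(F ⊕ G) n i j = F n i j + G n i j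
infixl 6 _⊕_

_⊖_ : Series → Series → Series
(F ⊖ G) n i j = F n i j - G n i j
infixl 6 _⊖_

mulU : Series → Series
mulU H n zero j = 0ℚ
mulU H n (suc i) j = H n i j

mulV : Series → Series
mulV H n i zero = 0ℚ
mulV H n i (suc j) = H n i j

mulZ : Series → Series
mulZ H zero i j = 0ℚ
mulZ H (suc n) i j = H n i j

swapUV : Series → Series
swapUV H n i j = H n j i

Symmetric : Series → Set
Symmetric H = swapUV H ≈ H

atV0 : Series → Series
atV0 H n i zero = H n i zero
atV0 H n i (suc j) = 0ℚ

-- (H(u,v) - H(0,v)) / u  (exact division)
divU : Series → Series
divU H n i j = H n (suc i) j

-- Λ H = (1+u)(1+zu) (H(u,v) - H(0,v))/u
Λ : Series → Series
Λ H = D ⊕ mulU D ⊕ mulZ (mulU D) ⊕ mulZ (mulU (mulU D))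
  where D = divU H

Λ^ : ℕ → Series → Series
Λ^ zero H = H
Λ^ (suc k) H = Λ (Λ^ k H)

mulFU : Series → Series
mulFU F = F ⊕ mulU F ⊕ mulZ (mulU F) ⊕ mulZ (mulU (mulU F))

mulFV : Series → Series
mulFV F = F ⊕ mulV F ⊕ mulZ (mulV F) ⊕ mulZ (mulV (mulV F))

-- The identity
--   H(u,v) = [u(1+v)(1+zv)H(u,0) - v(1+u)(1+zu)H(v,0)] / ((u-v)(1-zuv)),
-- stated with the denominator cleared:
--   (u-v)(1-zuv) H(u,v) = u(1+v)(1+zv)H(u,0) - v(1+u)(1+zu)H(v,0).
KernelIdentity : Series → Set
KernelIdentity H =
  (P ⊖ mulZ (mulU (mulV P)))
    ≈ (mulU (mulFV (atV0 H)) ⊖ mulV (mulFU (swapUV (atV0 H))))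
  where P = mulU H ⊖ mulV H

-- Everything is an identity between additive operators on ℚ[[z,u,v]] built
-- from multiplication by u, v, z and the evaluations H ↦ H(u,0), H(0,v).
-- Write D = (H(u,v) - H(0,v))/u, so that Λ H = (1+u)(1+zu) D, and note the
-- polynomial identity
--   u(1+v)(1+zv) - v(1+u)(1+zu) = (u-v)(1-zuv).
-- For symmetric H it turns the kernel identity into
--   u(1+v)(1+zv)(H - H(u,0)) = v(1+u)(1+zu)(H - H(0,v)),
-- i.e. uv (1+v)(1+zv) D(v,u) = uv (1+u)(1+zu) D(u,v), which after cancelling
-- uv says that Λ H is symmetric. For the induction step, the kernel identity
-- forces H(0,v) = H(v,0); then u(u-v)(1-zuv) Λ H = (1+u)(1+zu)(u-v)(1-zuv)(H - H(v,0)),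
-- and the right-hand side is computed from the kernel identity for H and from
-- H(u,0) - H(v,0) = u D(u,0) - v D(v,0).
module Submission where

open import Defs
open import Data.Maybe.Base using (Maybe; just; nothing)
open import Data.Nat using (ℕ; zero; suc; _≥_)
open import Data.Product using (_×_; _,_)
open import Data.Rational using (ℚ; 0ℚ; _+_; _-_)
open import Data.Rational.Properties using (+-*-commutativeRing; _≟_)
open import Function.Base using (id; _∘_)
open import Function.Bundles using (_⇔_; mk⇔)
open import Function.Properties.Equivalence using (⇔-setoid)
open import Level using (0ℓ)
open import Relation.Binary.Bundles using (Setoid)
open import Relation.Binary.PropositionalEquality using (_≡_; refl; sym; trans; cong₂; module ≡-Reasoning)
  renaming (cong to ≡-cong)
open import Relation.Nullary.Decidable using (yes; no)
import Relation.Binary.Reasoning.Setoid as SetoidReasoning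
import Tactic.RingSolver.Core.AlmostCommutativeRing as ACR
open import Tactic.RingSolver using (solve-∀)

ℚ-ring : ACR.AlmostCommutativeRing 0ℓ 0ℓ
ℚ-ring = ACR.fromCommutativeRing +-*-commutativeRing isZero
  where
  isZero : (x : ℚ) → Maybe (0ℚ ≡ x)
  isZero x with 0ℚ ≟ x
  ... | yes 0≡x = just 0≡x
  ... | no _    = nothing

+-interchange : ∀ a b c d → (a + b) + (c + d) ≡ (a + c) + (b + d)
+-interchange = solve-∀ ℚ-ring

[a-b]+[c-d]≡[a+c]-[b+d] : ∀ a b c d → (a - b) + (c - d) ≡ (a + c) - (b + d)
[a-b]+[c-d]≡[a+c]-[b+d] = solve-∀ ℚ-ring

[a+b]-[c+d]≡[a-c]+[b-d] : ∀ a b c d → (a + b) - (c + d) ≡ (a - c) + (b - d)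
[a+b]-[c+d]≡[a-c]+[b-d] = solve-∀ ℚ-ring

[a-b]-[c-d]≡[a-c]-[b-d] : ∀ a b c d → (a - b) - (c - d) ≡ (a - c) - (b - d)
[a-b]-[c-d]≡[a-c]-[b-d] = solve-∀ ℚ-ring

[a-c]-[b-c]≡a-b : ∀ a b c → (a - c) - (b - c) ≡ a - b
[a-c]-[b-c]≡a-b = solve-∀ ℚ-ring

p-p≡0 : ∀ p → p - p ≡ 0ℚ
p-p≡0 = solve-∀ ℚ-ring

p-0≡p : ∀ p → p - 0ℚ ≡ p
p-0≡p = solve-∀ ℚ-ring

a-b≡c-d⇒a-c≡b-d : ∀ a b c d → a - b ≡ c - d → a - c ≡ b - d
a-b≡c-d⇒a-c≡b-d a b c d e = begin
  a - c                           ≡⟨ regroup a b c d ⟩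
  ((a - b) - (c - d)) + (b - d)   ≡⟨ ≡-cong (λ t → (t - (c - d)) + (b - d)) e ⟩
  ((c - d) - (c - d)) + (b - d)   ≡⟨ cancel (c - d) (b - d) ⟩
  b - d                           ∎
  where
  open ≡-Reasoning
  regroup : ∀ a b c d → a - c ≡ ((a - b) - (c - d)) + (b - d)
  regroup = solve-∀ ℚ-ring
  cancel : ∀ x y → (x - x) + y ≡ y
  cancel = solve-∀ ℚ-ring

≈-refl : ∀ {F} → F ≈ F
≈-refl _ _ _ = refl

≈-sym : ∀ {F G} → F ≈ G → G ≈ F
≈-sym F≈G n i j = sym (F≈G n i j)

≈-trans : ∀ {F G K} → F ≈ G → G ≈ K → F ≈ K
≈-trans F≈G G≈K n i j = trans (F≈G n i j) (G≈K n i j)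

≈-setoid : Setoid 0ℓ 0ℓ
≈-setoid = record
  { Carrier       = Series
  ; _≈_           = _≈_
  ; isEquivalence = record { refl = ≈-refl ; sym = ≈-sym ; trans = ≈-trans }
  }

module ≈-Reasoning = SetoidReasoning ≈-setoid
module ⇔-Reasoning = SetoidReasoning (⇔-setoid 0ℓ)

⊕-cong : ∀ {F G F′ G′} → F ≈ F′ → G ≈ G′ → F ⊕ G ≈ F′ ⊕ G′
⊕-cong F≈F′ G≈G′ n i j = cong₂ _+_ (F≈F′ n i j) (G≈G′ n i j)

⊖-cong : ∀ {F G F′ G′} → F ≈ F′ → G ≈ G′ → F ⊖ G ≈ F′ ⊖ G′
⊖-cong F≈F′ G≈G′ n i j = cong₂ _-_ (F≈F′ n i j) (G≈G′ n i j)

≈-resp-⇔ : ∀ {F G F′ G′} → F ≈ F′ → G ≈ G′ → (F ≈ G) ⇔ (F′ ≈ G′)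
≈-resp-⇔ F≈F′ G≈G′ =
  mk⇔ (λ F≈G → ≈-trans (≈-sym F≈F′) (≈-trans F≈G G≈G′))
      (λ F′≈G′ → ≈-trans F≈F′ (≈-trans F′≈G′ (≈-sym G≈G′)))

⊖≈⊖-transpose : ∀ A B C D → (A ⊖ B ≈ C ⊖ D) ⇔ (A ⊖ C ≈ B ⊖ D)
⊖≈⊖-transpose A B C D = mk⇔
  (λ e n i j → a-b≡c-d⇒a-c≡b-d (A n i j) (B n i j) (C n i j) (D n i j) (e n i j))
  (λ e n i j → a-b≡c-d⇒a-c≡b-d (A n i j) (C n i j) (B n i j) (D n i j) (e n i j))

Op : Set
Op = Series → Series

infixl 6 _⊕ᵒ_ _⊖ᵒ_

_⊕ᵒ_ : Op → Op → Op
(f ⊕ᵒ g) F = f F ⊕ g F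

_⊖ᵒ_ : Op → Op → Op
(f ⊖ᵒ g) F = f F ⊖ g F

record Additive (f : Op) : Set where
  field
    cong  : ∀ {F G} → F ≈ G → f F ≈ f G
    ⊕-hom : ∀ F G → f (F ⊕ G) ≈ f F ⊕ f G
    ⊖-hom : ∀ F G → f (F ⊖ G) ≈ f F ⊖ f G

open Additive

id-additive : Additive id
id-additive = record { cong = id ; ⊕-hom = λ _ _ → ≈-refl ; ⊖-hom = λ _ _ → ≈-refl }

∘-additive : ∀ {f g} → Additive f → Additive g → Additive (f ∘ g)
∘-additive f-add g-add = record
  { cong  = λ F≈G → cong f-add (cong g-add F≈G)
  ; ⊕-hom = λ F G → ≈-trans (cong f-add (⊕-hom g-add F G)) (⊕-hom f-add _ _)
  ; ⊖-hom = λ F G → ≈-trans (cong f-add (⊖-hom g-add F G)) (⊖-hom f-add _ _)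
  }

⊕ᵒ-additive : ∀ {f g} → Additive f → Additive g → Additive (f ⊕ᵒ g)
⊕ᵒ-additive {f} {g} f-add g-add = record
  { cong  = λ F≈G → ⊕-cong (cong f-add F≈G) (cong g-add F≈G)
  ; ⊕-hom = λ F G → ≈-trans (⊕-cong (⊕-hom f-add F G) (⊕-hom g-add F G))
      (λ n i j → +-interchange (f F n i j) (f G n i j) (g F n i j) (g G n i j))
  ; ⊖-hom = λ F G → ≈-trans (⊕-cong (⊖-hom f-add F G) (⊖-hom g-add F G))
      (λ n i j → [a-b]+[c-d]≡[a+c]-[b+d] (f F n i j) (f G n i j) (g F n i j) (g G n i j))
  }

⊖ᵒ-additive : ∀ {f g} → Additive f → Additive g → Additive (f ⊖ᵒ g)
⊖ᵒ-additive {f} {g} f-add g-add = record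
  { cong  = λ F≈G → ⊖-cong (cong f-add F≈G) (cong g-add F≈G)
  ; ⊕-hom = λ F G → ≈-trans (⊖-cong (⊕-hom f-add F G) (⊕-hom g-add F G))
      (λ n i j → [a+b]-[c+d]≡[a-c]+[b-d] (f F n i j) (f G n i j) (g F n i j) (g G n i j))
  ; ⊖-hom = λ F G → ≈-trans (⊖-cong (⊖-hom f-add F G) (⊖-hom g-add F G))
      (λ n i j → [a-b]-[c-d]≡[a-c]-[b-d] (f F n i j) (f G n i j) (g F n i j) (g G n i j))
  }

record Intertwines (s f g : Op) : Set where
  constructor intertwining
  field
    intertwine : ∀ F → s (f F) ≈ g (s F)

open Intertwines

Commute : Op → Op → Set
Commute f g = Intertwines f g g

commute-sym : ∀ {f g} → Commute f g → Commute g f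
commute-sym fg = intertwining λ F → ≈-sym (intertwine fg F)

commute-refl : ∀ {f} → Commute f f
commute-refl = intertwining λ _ → ≈-refl

intertwines-id : ∀ {s} → Intertwines s id id
intertwines-id = intertwining λ _ → ≈-refl

intertwines-∘ : ∀ {s f₁ f₂ g₁ g₂} → Additive g₁ →
  Intertwines s f₁ g₁ → Intertwines s f₂ g₂ → Intertwines s (f₁ ∘ f₂) (g₁ ∘ g₂)
intertwines-∘ {f₂ = f₂} g₁-add s₁ s₂ = intertwining λ F →
  ≈-trans (intertwine s₁ (f₂ F)) (cong g₁-add (intertwine s₂ F))

intertwines-⊕ᵒ : ∀ {s f₁ f₂ g₁ g₂} → Additive s →
  Intertwines s f₁ g₁ → Intertwines s f₂ g₂ → Intertwines s (f₁ ⊕ᵒ f₂) (g₁ ⊕ᵒ g₂)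
intertwines-⊕ᵒ {f₁ = f₁} {f₂} s-add s₁ s₂ = intertwining λ F →
  ≈-trans (⊕-hom s-add (f₁ F) (f₂ F)) (⊕-cong (intertwine s₁ F) (intertwine s₂ F))

intertwines-⊖ᵒ : ∀ {s f₁ f₂ g₁ g₂} → Additive s →
  Intertwines s f₁ g₁ → Intertwines s f₂ g₂ → Intertwines s (f₁ ⊖ᵒ f₂) (g₁ ⊖ᵒ g₂)
intertwines-⊖ᵒ {f₁ = f₁} {f₂} s-add s₁ s₂ = intertwining λ F →
  ≈-trans (⊖-hom s-add (f₁ F) (f₂ F)) (⊖-cong (intertwine s₁ F) (intertwine s₂ F))

atU0 : Series → Series
atU0 H n zero    j = H n zero j
atU0 H n (suc i) j = 0ℚ

mulU-additive : Additive mulU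
mulU-additive = record
  { cong  = λ { F≈G n zero j → refl ; F≈G n (suc i) j → F≈G n i j }
  ; ⊕-hom = λ { F G n zero j → refl ; F G n (suc i) j → refl }
  ; ⊖-hom = λ { F G n zero j → refl ; F G n (suc i) j → refl }
  }

mulV-additive : Additive mulV
mulV-additive = record
  { cong  = λ { F≈G n i zero → refl ; F≈G n i (suc j) → F≈G n i j }
  ; ⊕-hom = λ { F G n i zero → refl ; F G n i (suc j) → refl }
  ; ⊖-hom = λ { F G n i zero → refl ; F G n i (suc j) → refl }
  }

mulZ-additive : Additive mulZ
mulZ-additive = record
  { cong  = λ { F≈G zero i j → refl ; F≈G (suc n) i j → F≈G n i j }
  ; ⊕-hom = λ { F G zero i j → refl ; F G (suc n) i j → refl }
  ; ⊖-hom = λ { F G zero i j → refl ; F G (suc n) i j → refl }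
  }

swapUV-additive : Additive swapUV
swapUV-additive = record
  { cong  = λ F≈G n i j → F≈G n j i
  ; ⊕-hom = λ _ _ → ≈-refl
  ; ⊖-hom = λ _ _ → ≈-refl
  }

atV0-additive : Additive atV0
atV0-additive = record
  { cong  = λ { F≈G n i zero → F≈G n i zero ; F≈G n i (suc j) → refl }
  ; ⊕-hom = λ { F G n i zero → refl ; F G n i (suc j) → refl }
  ; ⊖-hom = λ { F G n i zero → refl ; F G n i (suc j) → refl }
  }

mulU-mulV-commute : Commute mulU mulV
mulU-mulV-commute = intertwining λ where
  F n zero    zero    → refl
  F n zero    (suc j) → refl
  F n (suc i) zero    → refl
  F n (suc i) (suc j) → refl

mulU-mulZ-commute : Commute mulU mulZ
mulU-mulZ-commute = intertwining λ where
  F zero    zero    j → refl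
  F zero    (suc i) j → refl
  F (suc n) zero    j → refl
  F (suc n) (suc i) j → refl

mulV-mulZ-commute : Commute mulV mulZ
mulV-mulZ-commute = intertwining λ where
  F zero    i zero    → refl
  F zero    i (suc j) → refl
  F (suc n) i zero    → refl
  F (suc n) i (suc j) → refl

swapUV-mulU : Intertwines swapUV mulU mulV
swapUV-mulU = intertwining λ where
  F n i zero    → refl
  F n i (suc j) → refl

swapUV-mulZ : Commute swapUV mulZ
swapUV-mulZ = intertwining λ where
  F zero    i j → refl
  F (suc n) i j → refl

atV0-mulU : Commute atV0 mulU
atV0-mulU = intertwining λ where
  F n zero    zero    → refl
  F n zero    (suc j) → refl
  F n (suc i) zero    → refl
  F n (suc i) (suc j) → refl

atV0-mulZ : Commute atV0 mulZ
atV0-mulZ = intertwining λ where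
  F zero    i zero    → refl
  F zero    i (suc j) → refl
  F (suc n) i zero    → refl
  F (suc n) i (suc j) → refl

atV0-divU : Commute atV0 divU
atV0-divU = intertwining λ where
  F n i zero    → refl
  F n i (suc j) → refl

mulU-divU : ∀ F → mulU (divU F) ≈ F ⊖ atU0 F
mulU-divU F n zero    j = sym (p-p≡0 (F n zero j))
mulU-divU F n (suc i) j = sym (p-0≡p (F n (suc i) j))

atU0-symmetric : ∀ {H} → Symmetric H → atU0 H ≈ swapUV (atV0 H)
atU0-symmetric symH n zero    j = sym (symH n zero j)
atU0-symmetric symH n (suc i) j = refl

swapUV-atU0-atV0 : ∀ F → swapUV (atU0 (atV0 F)) ≈ atU0 (atV0 F)
swapUV-atU0-atV0 F n zero    zero    = refl
swapUV-atU0-atV0 F n zero    (suc j) = refl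
swapUV-atU0-atV0 F n (suc i) zero    = refl
swapUV-atU0-atV0 F n (suc i) (suc j) = refl

mulUV-injective⇔ : ∀ {F G} → (mulU (mulV F) ≈ mulU (mulV G)) ⇔ (F ≈ G)
mulUV-injective⇔ = mk⇔ (λ e n i j → e n (suc i) (suc j))
                       (λ F≈G → cong mulU-additive (cong mulV-additive F≈G))

mulU-injective : ∀ {F G} → mulU F ≈ mulU G → F ≈ G
mulU-injective e n i j = e n (suc i) j

-- mulFU and mulFV are definitionally mulF mulU and mulF mulV.
mulF : Op → Op
mulF x = id ⊕ᵒ x ⊕ᵒ mulZ ∘ x ⊕ᵒ mulZ ∘ x ∘ x

mulF-additive : ∀ {x} → Additive x → Additive (mulF x)
mulF-additive x-add =
  ⊕ᵒ-additive (⊕ᵒ-additive (⊕ᵒ-additive id-additive x-add) (∘-additive mulZ-additive x-add))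
              (∘-additive mulZ-additive (∘-additive x-add x-add))

intertwines-mulF : ∀ {s x y} → Additive s → Additive y →
  Intertwines s x y → Commute s mulZ → Intertwines s (mulF x) (mulF y)
intertwines-mulF s-add y-add sx sz =
  intertwines-⊕ᵒ s-add
    (intertwines-⊕ᵒ s-add (intertwines-⊕ᵒ s-add intertwines-id sx)
                          (intertwines-∘ mulZ-additive sz sx))
    (intertwines-∘ mulZ-additive sz (intertwines-∘ y-add sx sx))

mulFU-additive : Additive mulFU
mulFU-additive = mulF-additive mulU-additive

mulFV-additive : Additive mulFV
mulFV-additive = mulF-additive mulV-additive

mulKernel : Op
mulKernel = P ⊖ᵒ mulZ ∘ mulU ∘ mulV ∘ P
  where
  P : Op
  P = mulU ⊖ᵒ mulV

mulKernel-additive : Additive mulKernel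
mulKernel-additive =
  ⊖ᵒ-additive P-additive
    (∘-additive mulZ-additive (∘-additive mulU-additive (∘-additive mulV-additive P-additive)))
  where
  P-additive : Additive (mulU ⊖ᵒ mulV)
  P-additive = ⊖ᵒ-additive mulU-additive mulV-additive

commute-mulKernel : ∀ {s} → Additive s →
  Commute s mulU → Commute s mulV → Commute s mulZ → Commute s mulKernel
commute-mulKernel {s} s-add su sv sz =
  intertwines-⊖ᵒ s-add sP
    (intertwines-∘ mulZ-additive sz
      (intertwines-∘ mulU-additive su (intertwines-∘ mulV-additive sv sP)))
  where
  sP : Commute s (mulU ⊖ᵒ mulV)
  sP = intertwines-⊖ᵒ s-add su sv

mulZ-mulKernel : Commute mulZ mulKernel
mulZ-mulKernel = commute-mulKernel mulZ-additive
  (commute-sym mulU-mulZ-commute) (commute-sym mulV-mulZ-commute) commute-refl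

mulU-mulKernel : Commute mulU mulKernel
mulU-mulKernel = commute-mulKernel mulU-additive commute-refl mulU-mulV-commute mulU-mulZ-commute

mulKernel-mulFU : Commute mulKernel mulFU
mulKernel-mulFU = intertwines-mulF mulKernel-additive mulU-additive
  (commute-sym mulU-mulKernel) (commute-sym mulZ-mulKernel)

mulZ-mulFU : Commute mulZ mulFU
mulZ-mulFU = intertwines-mulF mulZ-additive mulU-additive (commute-sym mulU-mulZ-commute) commute-refl

mulU-mulFU : Commute mulU mulFU
mulU-mulFU = intertwines-mulF mulU-additive mulU-additive commute-refl mulU-mulZ-commute

mulU-mulFV : Commute mulU mulFV
mulU-mulFV = intertwines-mulF mulU-additive mulV-additive mulU-mulV-commute mulU-mulZ-commute

mulV-mulFU : Commute mulV mulFU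
mulV-mulFU = intertwines-mulF mulV-additive mulU-additive (commute-sym mulU-mulV-commute) mulV-mulZ-commute

mulV-mulFV : Commute mulV mulFV
mulV-mulFV = intertwines-mulF mulV-additive mulV-additive commute-refl mulV-mulZ-commute

mulFU-mulFV : Commute mulFU mulFV
mulFU-mulFV = intertwines-mulF mulFU-additive mulV-additive
  (commute-sym mulV-mulFU) (commute-sym mulZ-mulFU)

swapUV-mulFU : Intertwines swapUV mulFU mulFV
swapUV-mulFU = intertwines-mulF swapUV-additive mulV-additive swapUV-mulU swapUV-mulZ

atV0-mulFU : Commute atV0 mulFU
atV0-mulFU = intertwines-mulF atV0-additive mulU-additive atV0-mulU atV0-mulZ

mulF-expand : ∀ {s} x → Additive s → Commute s mulZ → ∀ F →
  s (mulF x F) ≈ ((s F ⊕ s (x F)) ⊕ mulZ (s (x F))) ⊕ mulZ (s (x (x F)))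
mulF-expand x s-add sz F =
  ≈-trans (⊕-hom s-add _ _)
    (⊕-cong (≈-trans (⊕-hom s-add _ _) (⊕-cong (⊕-hom s-add _ _) (intertwine sz (x F))))
            (intertwine sz (x (x F))))

mulKernel-expand : ∀ F → mulKernel F ≈ mulU (mulFV F) ⊖ mulV (mulFU F)
mulKernel-expand F = begin
  mulKernel F
    ≈⟨ ⊖-cong (≈-refl {uF ⊖ vF}) (⊖-hom zuv-additive uF vF) ⟩
  (uF ⊖ vF) ⊖ (mulZ (mulU (mulV uF)) ⊖ mulZ (mulU (mulV vF)))
    ≈⟨ ⊖-cong (≈-refl {uF ⊖ vF})
              (⊖-cong (cong mulZ-additive (cong mulU-additive vu≈uv)) (≈-refl {mulZ (mulU (mulV vF))})) ⟩
  (uF ⊖ vF) ⊖ (mulZ (mulU uvF) ⊖ mulZ (mulU (mulV vF)))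
    ≈⟨ (λ n i j → regroup (uF n i j) (vF n i j)
         (mulZ (mulU uvF) n i j) (mulZ (mulU (mulV vF)) n i j) (uvF n i j) (mulZ uvF n i j)) ⟩
  (((uF ⊕ uvF) ⊕ mulZ uvF) ⊕ mulZ (mulU (mulV vF)))
    ⊖ (((vF ⊕ uvF) ⊕ mulZ uvF) ⊕ mulZ (mulU uvF))
    ≈⟨ ⊖-cong (mulF-expand mulV mulU-additive mulU-mulZ-commute F)
              (≈-trans (mulF-expand mulU mulV-additive mulV-mulZ-commute F)
                 (⊕-cong (⊕-cong (⊕-cong (≈-refl {vF}) vu≈uv) (cong mulZ-additive vu≈uv))
                         (cong mulZ-additive vuu≈uuv))) ⟨
  mulU (mulFV F) ⊖ mulV (mulFU F) ∎
  where
  open ≈-Reasoning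
  uF vF uvF : Series
  uF = mulU F
  vF = mulV F
  uvF = mulU vF
  regroup : ∀ a b c d e g → (a - b) - (c - d) ≡ (((a + e) + g) + d) - (((b + e) + g) + c)
  regroup = solve-∀ ℚ-ring
  zuv-additive : Additive (mulZ ∘ mulU ∘ mulV)
  zuv-additive = ∘-additive mulZ-additive (∘-additive mulU-additive mulV-additive)
  vu≈uv : mulV uF ≈ uvF
  vu≈uv = ≈-sym (intertwine mulU-mulV-commute F)
  vuu≈uuv : mulV (mulU uF) ≈ mulU uvF
  vuu≈uuv = ≈-trans (≈-sym (intertwine mulU-mulV-commute uF)) (cong mulU-additive vu≈uv)

kernelRHS : Op
kernelRHS H = mulU (mulFV (atV0 H)) ⊖ mulV (mulFU (swapUV (atV0 H)))

symmetric-Λ⇔kernelIdentity : ∀ {H} → Symmetric H → Symmetric (Λ H) ⇔ KernelIdentity H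
symmetric-Λ⇔kernelIdentity {H} symH = begin
  swapUV (mulFU D) ≈ mulFU D
    ≈⟨ ≈-resp-⇔ (intertwine swapUV-mulFU D) (≈-refl {mulFU D}) ⟩
  mulFV (swapUV D) ≈ mulFU D
    ≈⟨ mulUV-injective⇔ ⟨
  mulU (mulV (mulFV (swapUV D))) ≈ mulU (mulV (mulFU D))
    ≈⟨ ≈-resp-⇔ (cong mulU-additive (intertwine mulV-mulFV (swapUV D)))
                (≈-trans (intertwine mulU-mulV-commute (mulFU D))
                         (cong mulV-additive (intertwine mulU-mulFU D))) ⟩
  mulU (mulFV (mulV (swapUV D))) ≈ mulV (mulFU (mulU D))
    ≈⟨ ≈-resp-⇔ (cong uFV-additive vD′≈H⊖A) (cong vFU-additive uD≈H⊖B) ⟩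
  mulU (mulFV (H ⊖ A)) ≈ mulV (mulFU (H ⊖ B))
    ≈⟨ ≈-resp-⇔ (⊖-hom uFV-additive H A) (⊖-hom vFU-additive H B) ⟩
  mulU (mulFV H) ⊖ mulU (mulFV A) ≈ mulV (mulFU H) ⊖ mulV (mulFU B)
    ≈⟨ ⊖≈⊖-transpose (mulU (mulFV H)) (mulV (mulFU H)) (mulU (mulFV A)) (mulV (mulFU B)) ⟨
  mulU (mulFV H) ⊖ mulV (mulFU H) ≈ kernelRHS H
    ≈⟨ ≈-resp-⇔ (≈-sym (mulKernel-expand H)) (≈-refl {kernelRHS H}) ⟩
  KernelIdentity H ∎
  where
  open ⇔-Reasoning
  D A B : Series
  D = divU H
  A = atV0 H
  B = swapUV A
  uFV-additive : Additive (mulU ∘ mulFV)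
  uFV-additive = ∘-additive mulU-additive mulFV-additive
  vFU-additive : Additive (mulV ∘ mulFU)
  vFU-additive = ∘-additive mulV-additive mulFU-additive
  uD≈H⊖B : mulU D ≈ H ⊖ B
  uD≈H⊖B = ≈-trans (mulU-divU H) (⊖-cong (≈-refl {H}) (atU0-symmetric symH))
  vD′≈H⊖A : mulV (swapUV D) ≈ H ⊖ A
  vD′≈H⊖A = ≈-trans (≈-sym (intertwine swapUV-mulU D))
              (≈-trans (cong swapUV-additive uD≈H⊖B) (⊖-cong symH (≈-refl {A})))

-- The coefficient of v^{j+2} in the kernel identity at u = 0 reads -H(0,j+1) = -H(j+1,0).
kernelIdentity⇒atU0 : ∀ {F} → KernelIdentity F → atU0 F ≈ swapUV (atV0 F)
kernelIdentity⇒atU0 {F} ki = coefficient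
  where
  neg-injective : ∀ a b → (0ℚ - a) - 0ℚ ≡ 0ℚ - (((b + 0ℚ) + 0ℚ) + 0ℚ) → a ≡ b
  neg-injective a b e = begin
    a                                  ≡⟨ negate a ⟩
    0ℚ - ((0ℚ - a) - 0ℚ)               ≡⟨ ≡-cong (0ℚ -_) e ⟩
    0ℚ - (0ℚ - (((b + 0ℚ) + 0ℚ) + 0ℚ)) ≡⟨ unpad b ⟩
    b                                  ∎
    where
    open ≡-Reasoning
    negate : ∀ a → a ≡ 0ℚ - ((0ℚ - a) - 0ℚ)
    negate = solve-∀ ℚ-ring
    unpad : ∀ b → 0ℚ - (0ℚ - (((b + 0ℚ) + 0ℚ) + 0ℚ)) ≡ b
    unpad = solve-∀ ℚ-ring
  coefficient : atU0 F ≈ swapUV (atV0 F)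
  coefficient n       zero    zero    = refl
  coefficient zero    zero    (suc j) = neg-injective _ _ (ki zero zero (suc (suc j)))
  coefficient (suc n) zero    (suc j) = neg-injective _ _ (ki (suc n) zero (suc (suc j)))
  coefficient n       (suc i) j       = refl

atV0-⊖-swapUV : ∀ F →
  atV0 F ⊖ swapUV (atV0 F) ≈ mulU (atV0 (divU F)) ⊖ mulV (swapUV (atV0 (divU F)))
atV0-⊖-swapUV F = ≈-sym (begin
  mulU D₀ ⊖ mulV (swapUV D₀)
    ≈⟨ ⊖-cong (cong mulU-additive (intertwine atV0-divU F))
              (cong mulV-additive (cong swapUV-additive (intertwine atV0-divU F))) ⟩
  mulU (divU A) ⊖ mulV (swapUV (divU A))
    ≈⟨ ⊖-cong (mulU-divU A)
              (≈-trans (≈-sym (intertwine swapUV-mulU (divU A)))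
                 (≈-trans (cong swapUV-additive (mulU-divU A))
                          (⊖-cong (≈-refl {swapUV A}) (swapUV-atU0-atV0 F)))) ⟩
  (A ⊖ atU0 A) ⊖ (swapUV A ⊖ atU0 A)
    ≈⟨ (λ n i j → [a-c]-[b-c]≡a-b (A n i j) (swapUV A n i j) (atU0 A n i j)) ⟩
  A ⊖ swapUV A ∎)
  where
  open ≈-Reasoning
  A D₀ : Series
  A = atV0 F
  D₀ = atV0 (divU F)

kernelRHS⊖mulKernel : ∀ F →
  kernelRHS F ⊖ mulKernel (swapUV (atV0 F)) ≈ mulU (mulFV (atV0 F ⊖ swapUV (atV0 F)))
kernelRHS⊖mulKernel F = begin
  kernelRHS F ⊖ mulKernel B
    ≈⟨ ⊖-cong (≈-refl {kernelRHS F}) (mulKernel-expand B) ⟩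
  (mulU (mulFV A) ⊖ vFUB) ⊖ (mulU (mulFV B) ⊖ vFUB)
    ≈⟨ (λ n i j → [a-c]-[b-c]≡a-b (mulU (mulFV A) n i j) (mulU (mulFV B) n i j) (vFUB n i j)) ⟩
  mulU (mulFV A) ⊖ mulU (mulFV B)
    ≈⟨ ⊖-hom (∘-additive mulU-additive mulFV-additive) A B ⟨
  mulU (mulFV (A ⊖ B)) ∎
  where
  open ≈-Reasoning
  A B vFUB : Series
  A = atV0 F
  B = swapUV A
  vFUB = mulV (mulFU B)

kernelRHS-mulFU : ∀ G →
  kernelRHS (mulFU G) ≈ mulU (mulFV (mulFU (atV0 G))) ⊖ mulV (mulFU (mulFV (swapUV (atV0 G))))
kernelRHS-mulFU G =
  ⊖-cong (cong (∘-additive mulU-additive mulFV-additive) (intertwine atV0-mulFU G))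
         (cong (∘-additive mulV-additive mulFU-additive)
            (≈-trans (cong swapUV-additive (intertwine atV0-mulFU G))
                     (intertwine swapUV-mulFU (atV0 G))))

mulFU-mulU-mulFV-⊖ : ∀ X Y →
  mulFU (mulU (mulFV (mulU X ⊖ mulV Y)))
    ≈ mulU (mulU (mulFV (mulFU X)) ⊖ mulV (mulFU (mulFV Y)))
mulFU-mulU-mulFV-⊖ X Y = begin
  mulFU (mulU (mulFV (mulU X ⊖ mulV Y)))
    ≈⟨ ⊖-hom (∘-additive mulFU-additive (∘-additive mulU-additive mulFV-additive)) (mulU X) (mulV Y) ⟩
  mulFU (mulU (mulFV (mulU X))) ⊖ mulFU (mulU (mulFV (mulV Y)))
    ≈⟨ ⊖-cong X-part Y-part ⟩
  mulU (mulU (mulFV (mulFU X))) ⊖ mulU (mulV (mulFU (mulFV Y)))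
    ≈⟨ ⊖-hom mulU-additive _ _ ⟨
  mulU (mulU (mulFV (mulFU X)) ⊖ mulV (mulFU (mulFV Y))) ∎
  where
  open ≈-Reasoning
  X-part : mulFU (mulU (mulFV (mulU X))) ≈ mulU (mulU (mulFV (mulFU X)))
  X-part = begin
    mulFU (mulU (mulFV (mulU X))) ≈⟨ intertwine mulU-mulFU _ ⟨
    mulU (mulFU (mulFV (mulU X))) ≈⟨ cong mulU-additive (cong mulFU-additive (intertwine mulU-mulFV X)) ⟨
    mulU (mulFU (mulU (mulFV X))) ≈⟨ cong mulU-additive (intertwine mulU-mulFU _) ⟨
    mulU (mulU (mulFU (mulFV X))) ≈⟨ cong mulU-additive (cong mulU-additive (intertwine mulFU-mulFV X)) ⟩
    mulU (mulU (mulFV (mulFU X))) ∎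
  Y-part : mulFU (mulU (mulFV (mulV Y))) ≈ mulU (mulV (mulFU (mulFV Y)))
  Y-part = begin
    mulFU (mulU (mulFV (mulV Y))) ≈⟨ intertwine mulU-mulFU _ ⟨
    mulU (mulFU (mulFV (mulV Y))) ≈⟨ cong mulU-additive (cong mulFU-additive (intertwine mulV-mulFV Y)) ⟨
    mulU (mulFU (mulV (mulFV Y))) ≈⟨ cong mulU-additive (intertwine mulV-mulFU _) ⟨
    mulU (mulV (mulFU (mulFV Y))) ∎

kernelIdentity-Λ : ∀ {F} → KernelIdentity F → KernelIdentity (Λ F)
kernelIdentity-Λ {F} ki = mulU-injective (begin
  mulU (mulKernel (mulFU D))
    ≈⟨ intertwine mulU-mulKernel (mulFU D) ⟩
  mulKernel (mulU (mulFU D))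
    ≈⟨ cong mulKernel-additive (intertwine mulU-mulFU D) ⟩
  mulKernel (mulFU (mulU D))
    ≈⟨ intertwine mulKernel-mulFU (mulU D) ⟩
  mulFU (mulKernel (mulU D))
    ≈⟨ cong (∘-additive mulFU-additive mulKernel-additive) uD≈F⊖B ⟩
  mulFU (mulKernel (F ⊖ B))
    ≈⟨ cong mulFU-additive (⊖-hom mulKernel-additive F B) ⟩
  mulFU (mulKernel F ⊖ mulKernel B)
    ≈⟨ cong mulFU-additive (≈-trans (⊖-cong ki (≈-refl {mulKernel B})) (kernelRHS⊖mulKernel F)) ⟩
  mulFU (mulU (mulFV (atV0 F ⊖ B)))
    ≈⟨ cong (∘-additive mulFU-additive (∘-additive mulU-additive mulFV-additive)) (atV0-⊖-swapUV F) ⟩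
  mulFU (mulU (mulFV (mulU D₀ ⊖ mulV (swapUV D₀))))
    ≈⟨ mulFU-mulU-mulFV-⊖ D₀ (swapUV D₀) ⟩
  mulU (mulU (mulFV (mulFU D₀)) ⊖ mulV (mulFU (mulFV (swapUV D₀))))
    ≈⟨ cong mulU-additive (kernelRHS-mulFU D) ⟨
  mulU (kernelRHS (mulFU D)) ∎)
  where
  open ≈-Reasoning
  D D₀ B : Series
  D = divU F
  D₀ = atV0 D
  B = swapUV (atV0 F)
  uD≈F⊖B : mulU D ≈ F ⊖ B
  uD≈F⊖B = ≈-trans (mulU-divU F) (⊖-cong (≈-refl {F}) (kernelIdentity⇒atU0 ki))

kernelIdentity-Λ^ : ∀ {H} → KernelIdentity H → ∀ k → KernelIdentity (Λ^ k H)
kernelIdentity-Λ^ ki zero    = ki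
kernelIdentity-Λ^ ki (suc k) = kernelIdentity-Λ (kernelIdentity-Λ^ ki k)

-- The identities hold in ℚ[[z,u,v]], so polynomiality of the coefficients is not needed.
lemma3p3 : (H : Series) → PolyCoeffs H → Symmetric H →
    (Symmetric (Λ H) ⇔ KernelIdentity H)
    × (KernelIdentity H → KernelIdentity (Λ H))
    × (KernelIdentity H → (k : ℕ) → k ≥ 1 → KernelIdentity (Λ^ k H))
lemma3p3 H _ symH =
  symmetric-Λ⇔kernelIdentity symH , kernelIdentity-Λ , λ ki k _ → kernelIdentity-Λ^ ki k
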